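{- Let $p,q,r$ be pairwise distinct primes, $\alpha,\beta,\gamma\geq 1$ integers, $m\in\{p^{\alpha}q^{\beta},\,p^{\alpha}q^{\beta}r^{\gamma}\}$, and $\Gamma=\mathrm{Cay}(\mathbb{Z}_{p}\times\mathbb{Z}_{m},\Phi)$ with $\Phi=\varphi_p\times\varphi_m$. Then (1) $\mathrm{diam}(\Gamma)=3$ if one of the prime factors of $m$ is $2$; (2) $\mathrm{diam}(\Gamma)=2$ if all prime factors of $m$ are at least $3$.
   Context: For $n\geq 1$, $\mathbb{Z}_n=\{0,\dots,n-1\}$ is the integers mod $n$ and $\varphi_n$ is the set of elements of $\mathbb{Z}_n$ coprime to $n$ ($\varphi_p=\mathbb{Z}_p\setminus\{0\}$ for $p$ prime). $\mathrm{Cay}(\mathbb{Z}_p\times\mathbb{Z}_m,\varphi_p\times\varphi_m)$ is the graph on $\mathbb{Z}_p\times\mathbb{Z}_m$ where $(u,v)\sim(u',v')$ iff $u-u'\in\varphi_p$ and $v-v'\in\varphi_m$. The diameter of a connected graph is the maximum distance between two vertices; by convention, the diameter of a disconnected graph is the maximum of the diameters of its connected components. -}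

module Defs where

open import Data.Nat using (ℕ; zero; suc; _+_; _∸_; _≤ᵇ_; _≤_; _<_)
open import Data.Nat.Coprimality using (Coprime)
open import Data.Fin using (Fin; toℕ)
open import Data.Bool using (if_then_else_)
open import Data.Product using (_×_; _,_; ∃-syntax; Σ-syntax)
open import Relation.Nullary using (¬_)
open import Relation.Binary.PropositionalEquality using (_≡_)

-- (a - b) mod n (used with k = n), as a natural number in {0,...,n-1}, for a b ∈ ℤ_n = Fin n
_⊖[_]_ : {n : ℕ} → Fin n → (k : ℕ) → Fin n → ℕ
a ⊖[ k ] b = if toℕ b ≤ᵇ toℕ a then toℕ a ∸ toℕ b else k ∸ (toℕ b ∸ toℕ a)

Inφ : ℕ → ℕ → Set
Inφ n x = Coprime x n

V : ℕ → ℕ → Set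
V p m = Fin p × Fin m

Adj : (p m : ℕ) → V p m → V p m → Set
Adj p m (u , v) (u' , v') = Inφ p (u ⊖[ p ] u') × Inφ m (v ⊖[ m ] v')

data Walk (p m : ℕ) : V p m → V p m → ℕ → Set where
  here  : ∀ {x} → Walk p m x x 0
  step  : ∀ {x y z k} → Adj p m x y → Walk p m y z k → Walk p m x z (suc k)

Reachable : (p m : ℕ) → V p m → V p m → Set
Reachable p m x y = ∃[ k ] Walk p m x y k

Dist : (p m : ℕ) → V p m → V p m → ℕ → Set
Dist p m x y d = Walk p m x y d × (∀ k → k < d → ¬ Walk p m x y k)

-- diameter = d : maximum distance between two vertices of the same
-- connected component (= diameter for connected graphs; for disconnected
-- graphs the maximum of the diameters of the components)
Diameter : (p m : ℕ) → ℕ → Set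
Diameter p m d =
  (∀ x y → Reachable p m x y → Σ[ k ∈ ℕ ] (k ≤ d × Walk p m x y k))
  × (Σ[ x ∈ V p m ] Σ[ y ∈ V p m ] Dist p m x y d)

module Submission where

-- Two vertices (u , v) and (u' , v') are joined by the walk (u , v) ~ (a , c) ~ (u' , v') as soon as
-- a ∉ {u , u'} and both v − c and c − v' are units of ℤₘ.  Such a c exists unless m is even and v − v' is
-- odd: if E is the product of the prime factors of m not dividing e = v − v', then c = v' + 2e + E works.
-- If m is even, every unit of ℤₘ is odd, so each edge flips the parity of the ℤₘ-coordinate (and, for
-- p = 2, of the ℤₚ-coordinate as well): between suitable non-adjacent vertices every walk has odd length,
-- so the diameter is at least 3, and one preliminary step v ↦ v + 1 repairs the parity for the walk above.
-- If all prime factors of m are odd, then p ≥ 3 and every pair of vertices is at distance at most 2.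

open import Defs
open import Data.Bool using (true; false; T)
open import Data.Fin using (Fin; toℕ; zero; suc)
open import Data.Fin.Properties using (toℕ<n; toℕ-injective; toℕ-fromℕ<) renaming (_≟_ to _≟ᶠ_)
open import Data.List using ([]; _∷_; filter)
open import Data.List.Membership.Propositional using (_∈_)
open import Data.List.Membership.Propositional.Properties using (∈-filter⁺; ∈-filter⁻)
open import Data.List.Relation.Unary.All using (_∷_)
import Data.List.Relation.Unary.All.Properties as All
open import Data.Nat
  using (ℕ; zero; suc; _+_; _*_; _^_; _∸_; _≤_; _<_; _≤ᵇ_; z≤n; s≤s; _≟_
        ; NonZero; ≢-nonZero; ≢-nonZero⁻¹; nonTrivial⇒n>1)
open import Data.Nat.Properties
  using (≤-refl; ≤-trans; <⇒≤; ≰⇒>; ≤ᵇ⇒≤; ≤⇒≤ᵇ; ≤∧≢⇒<; +-identityʳ; +-comm; +-assoc; +-suc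
        ; +-cancelʳ-≡; *-assoc; m∸n+n≡m; m∸n≤m; m*n≢0; m^n≢0)
open import Data.Nat.Coprimality using (Coprime; 1-coprimeTo)
open import Data.Nat.Divisibility
open import Data.Nat.DivMod using (_%_; _/_; _mod_; [m+kn]%n≡m%n; m≡m%n+[m/n]*n; m<n⇒m%n≡m; m%n<n)
open import Data.Nat.ListAction using (product)
open import Data.Nat.ListAction.Properties using (∈⇒∣product)
open import Data.Nat.Primality
  using (Prime; prime⇒irreducible; prime⇒nonZero; prime⇒nonTrivial; euclidsLemma; ¬prime[1]; prime[2])
open import Data.Nat.Primality.Factorisation
  using (PrimeFactorisation; factorise; factors; factorisationHasAllPrimeFactors)
open PrimeFactorisation using (isFactorisation; factorsPrime)
open import Data.Nat.Tactic.RingSolver using (solve-∀)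
open import Data.Product using (_×_; _,_; ∃₂; ∃-syntax; proj₁; proj₂)
open import Data.Sum using (_⊎_; inj₁; inj₂; [_,_])
open import Function using (_∘_)
open import Level using (0ℓ)
open import Relation.Binary.Bundles using (Setoid)
open import Relation.Binary.PropositionalEquality
  using (_≡_; _≢_; ≢-sym; refl; sym; trans; cong; cong₂; subst; module ≡-Reasoning)
import Relation.Binary.Reasoning.Setoid as SetoidReasoning
open import Relation.Binary.Structures using (IsEquivalence)
open import Relation.Nullary using (¬_; contradiction; yes; no; ¬?)

infix 4 _≡_[mod_]

_≡_[mod_] : ℕ → ℕ → ℕ → Set
x ≡ y [mod n ] = ∃₂ λ a b → x + a * n ≡ y + b * n

module _ {n : ℕ} where

  ≡[mod]-reflexive : ∀ {x y} → x ≡ y → x ≡ y [mod n ]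
  ≡[mod]-reflexive refl = 0 , 0 , refl

  ≡[mod]-refl : ∀ {x} → x ≡ x [mod n ]
  ≡[mod]-refl = ≡[mod]-reflexive refl

  ≡[mod]-sym : ∀ {x y} → x ≡ y [mod n ] → y ≡ x [mod n ]
  ≡[mod]-sym (a , b , e) = b , a , sym e

  ≡[mod]-trans : ∀ {x y z} → x ≡ y [mod n ] → y ≡ z [mod n ] → x ≡ z [mod n ]
  ≡[mod]-trans {x} {y} {z} (a , b , e) (c , d , f) = a + c , b + d , (begin
    x + (a + c) * n       ≡⟨ split x a c n ⟩
    (x + a * n) + c * n   ≡⟨ cong (_+ c * n) e ⟩
    (y + b * n) + c * n   ≡⟨ swap y b c n ⟩
    (y + c * n) + b * n   ≡⟨ cong (_+ b * n) f ⟩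
    (z + d * n) + b * n   ≡⟨ swap z d b n ⟩
    (z + b * n) + d * n   ≡⟨ split z b d n ⟨
    z + (b + d) * n       ∎)
    where
    open ≡-Reasoning
    split : ∀ w i j k → w + (i + j) * k ≡ (w + i * k) + j * k
    split = solve-∀
    swap : ∀ w i j k → (w + i * k) + j * k ≡ (w + j * k) + i * k
    swap = solve-∀

  ≡[mod]-isEquivalence : IsEquivalence (λ x y → x ≡ y [mod n ])
  ≡[mod]-isEquivalence = record { refl = ≡[mod]-refl ; sym = ≡[mod]-sym ; trans = ≡[mod]-trans }

  ≡[mod]-setoid : Setoid 0ℓ 0ℓ
  ≡[mod]-setoid = record { isEquivalence = ≡[mod]-isEquivalence }

  +-cong[mod] : ∀ {x y u v} → x ≡ y [mod n ] → u ≡ v [mod n ] → x + u ≡ y + v [mod n ]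
  +-cong[mod] {x} {y} {u} {v} (a , b , e) (c , d , f) = a + c , b + d , (begin
    (x + u) + (a + c) * n       ≡⟨ shuffle x u a c n ⟩
    (x + a * n) + (u + c * n)   ≡⟨ cong₂ _+_ e f ⟩
    (y + b * n) + (v + d * n)   ≡⟨ shuffle y v b d n ⟨
    (y + v) + (b + d) * n       ∎)
    where
    open ≡-Reasoning
    shuffle : ∀ w z i j k → (w + z) + (i + j) * k ≡ (w + i * k) + (z + j * k)
    shuffle = solve-∀

  +-cancelʳ[mod] : ∀ {x y} v → x + v ≡ y + v [mod n ] → x ≡ y [mod n ]
  +-cancelʳ[mod] {x} {y} v (a , b , e) = a , b , +-cancelʳ-≡ v _ _ (begin
    (x + a * n) + v   ≡⟨ rotate x v a n ⟩
    (x + v) + a * n   ≡⟨ e ⟩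
    (y + v) + b * n   ≡⟨ rotate y v b n ⟨
    (y + b * n) + v   ∎)
    where
    open ≡-Reasoning
    rotate : ∀ w z i k → (w + i * k) + z ≡ (w + z) + i * k
    rotate = solve-∀

  n+x≡x[mod] : ∀ x → n + x ≡ x [mod n ]
  n+x≡x[mod] x = 0 , 1 , trans (+-identityʳ (n + x)) (trans (+-comm n x) (cong (x +_) (sym (+-identityʳ n))))

  ∣⇒≡0[mod] : ∀ {x} → n ∣ x → x ≡ 0 [mod n ]
  ∣⇒≡0[mod] (divides k refl) = 0 , k , +-identityʳ (k * n)

  ∣-resp-≡[mod] : ∀ {x y} → x ≡ y [mod n ] → n ∣ x → n ∣ y
  ∣-resp-≡[mod] {x} {y} (a , b , e) n∣x = ∣m+n∣m⇒∣n n∣b*n+y (n∣m*n b)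
    where
    n∣b*n+y : n ∣ b * n + y
    n∣b*n+y = subst (n ∣_) (trans e (+-comm y (b * n))) (∣m∣n⇒∣m+n n∣x (n∣m*n a))

  ≡[mod]-divisor : ∀ {d x y} → d ∣ n → x ≡ y [mod n ] → x ≡ y [mod d ]
  ≡[mod]-divisor {d} {x} {y} (divides k refl) (a , b , e) = a * k , b * k , (begin
    x + a * k * d     ≡⟨ cong (x +_) (*-assoc a k d) ⟩
    x + a * (k * d)   ≡⟨ e ⟩
    y + b * (k * d)   ≡⟨ cong (y +_) (*-assoc b k d) ⟨
    y + b * k * d     ∎)
    where open ≡-Reasoning

  ≡[mod]⇒%≡ : .{{_ : NonZero n}} → ∀ {x y} → x ≡ y [mod n ] → x % n ≡ y % n
  ≡[mod]⇒%≡ {x} {y} (a , b , e) = begin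
    x % n             ≡⟨ [m+kn]%n≡m%n x a n ⟨
    (x + a * n) % n   ≡⟨ cong (_% n) e ⟩
    (y + b * n) % n   ≡⟨ [m+kn]%n≡m%n y b n ⟩
    y % n             ∎
    where open ≡-Reasoning

  ≡[mod]⇒≡ : .{{_ : NonZero n}} → ∀ {x y} → x < n → y < n → x ≡ y [mod n ] → x ≡ y
  ≡[mod]⇒≡ x<n y<n e = trans (sym (m<n⇒m%n≡m x<n)) (trans (≡[mod]⇒%≡ e) (m<n⇒m%n≡m y<n))

  toℕ-mod : .{{_ : NonZero n}} → ∀ x → toℕ (x mod n) ≡ x [mod n ]
  toℕ-mod x = x / n , 0 , (begin
    toℕ (x mod n) + x / n * n   ≡⟨ cong (_+ x / n * n) (toℕ-fromℕ< (m%n<n x n)) ⟩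
    x % n + x / n * n           ≡⟨ m≡m%n+[m/n]*n x n ⟨
    x                           ≡⟨ +-identityʳ x ⟨
    x + 0 * n                   ∎)
    where open ≡-Reasoning

module ≡[mod]-Reasoning (n : ℕ) = SetoidReasoning (≡[mod]-setoid {n})

parity : ∀ x → x ≡ 0 [mod 2 ] ⊎ x ≡ 1 [mod 2 ]
parity zero = inj₁ ≡[mod]-refl
parity (suc x) with parity x
... | inj₁ even = inj₂ (+-cong[mod] (≡[mod]-refl {x = 1}) even)
... | inj₂ odd  = inj₁ (≡[mod]-trans (+-cong[mod] (≡[mod]-refl {x = 1}) odd) (n+x≡x[mod] 0))

0≢1[mod2] : ¬ 0 ≡ 1 [mod 2 ]
0≢1[mod2] 0≡1 with ≡[mod]⇒%≡ 0≡1
... | ()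

odd⇒≡1[mod2] : ∀ {x} → ¬ 2 ∣ x → x ≡ 1 [mod 2 ]
odd⇒≡1[mod2] {x} 2∤x with parity x
... | inj₁ even = contradiction (∣-resp-≡[mod] (≡[mod]-sym even) (2 ∣0)) 2∤x
... | inj₂ odd  = odd

module _ {n : ℕ} where

  ⊖-+-≡ : (a b : Fin n) → (a ⊖[ n ] b) + toℕ b ≡ toℕ a [mod n ]
  ⊖-+-≡ a b with toℕ b ≤ᵇ toℕ a in b≤ᵇa
  ... | true  = ≡[mod]-reflexive (m∸n+n≡m (≤ᵇ⇒≤ (toℕ b) (toℕ a) (subst T (sym b≤ᵇa) _)))
  ... | false = ≡[mod]-trans (≡[mod]-reflexive wraps) (n+x≡x[mod] (toℕ a))
    where
    a<b : toℕ a < toℕ b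
    a<b = ≰⇒> (λ b≤a → subst T b≤ᵇa (≤⇒≤ᵇ b≤a))
    b∸a≤n : toℕ b ∸ toℕ a ≤ n
    b∸a≤n = ≤-trans (m∸n≤m (toℕ b) (toℕ a)) (<⇒≤ (toℕ<n b))
    wraps : n ∸ (toℕ b ∸ toℕ a) + toℕ b ≡ n + toℕ a
    wraps = begin
      n ∸ (toℕ b ∸ toℕ a) + toℕ b                       ≡⟨ cong (n ∸ (toℕ b ∸ toℕ a) +_) (m∸n+n≡m (<⇒≤ a<b)) ⟨
      n ∸ (toℕ b ∸ toℕ a) + ((toℕ b ∸ toℕ a) + toℕ a)   ≡⟨ +-assoc (n ∸ (toℕ b ∸ toℕ a)) _ _ ⟨
      (n ∸ (toℕ b ∸ toℕ a) + (toℕ b ∸ toℕ a)) + toℕ a   ≡⟨ cong (_+ toℕ a) (m∸n+n≡m b∸a≤n) ⟩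
      n + toℕ a                                         ∎
      where open ≡-Reasoning

  ⊖-self : (a : Fin n) → a ⊖[ n ] a ≡ 0 [mod n ]
  ⊖-self a = +-cancelʳ[mod] (toℕ a) (⊖-+-≡ a a)

  ∣⊖⇒≡[mod] : ∀ {d} → d ∣ n → (a b : Fin n) → d ∣ a ⊖[ n ] b → toℕ a ≡ toℕ b [mod d ]
  ∣⊖⇒≡[mod] {d} d∣n a b d∣a⊖b = begin
    toℕ a                   ≈⟨ ≡[mod]-divisor d∣n (⊖-+-≡ a b) ⟨
    (a ⊖[ n ] b) + toℕ b    ≈⟨ +-cong[mod] (∣⇒≡0[mod] d∣a⊖b) ≡[mod]-refl ⟩
    toℕ b                   ∎
    where open ≡[mod]-Reasoning d

  ≡[mod]⇒∣⊖ : ∀ {d} → d ∣ n → (a b : Fin n) → toℕ a ≡ toℕ b [mod d ] → d ∣ a ⊖[ n ] b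
  ≡[mod]⇒∣⊖ {d} d∣n a b a≡b = ∣-resp-≡[mod] (≡[mod]-sym a⊖b≡0) (d ∣0)
    where
    a⊖b≡0 : a ⊖[ n ] b ≡ 0 [mod d ]
    a⊖b≡0 = +-cancelʳ[mod] (toℕ b) (≡[mod]-trans (≡[mod]-divisor d∣n (⊖-+-≡ a b)) a≡b)

  module _ .{{_ : NonZero n}} where

    ⊖-shift : (s : ℕ) (b : Fin n) → ((s + toℕ b) mod n) ⊖[ n ] b ≡ s [mod n ]
    ⊖-shift s b = +-cancelʳ[mod] (toℕ b) (≡[mod]-trans (⊖-+-≡ c b) (toℕ-mod (s + toℕ b)))
      where
      c : Fin n
      c = (s + toℕ b) mod n

    ⊖-+-shift : (s : ℕ) (a b : Fin n) → (a ⊖[ n ] ((s + toℕ b) mod n)) + s ≡ a ⊖[ n ] b [mod n ]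
    ⊖-+-shift s a b = +-cancelʳ[mod] (toℕ b) (begin
      ((a ⊖[ n ] c) + s) + toℕ b   ≡⟨ +-assoc (a ⊖[ n ] c) s (toℕ b) ⟩
      (a ⊖[ n ] c) + (s + toℕ b)   ≈⟨ +-cong[mod] ≡[mod]-refl (toℕ-mod (s + toℕ b)) ⟨
      (a ⊖[ n ] c) + toℕ c         ≈⟨ ⊖-+-≡ a c ⟩
      toℕ a                        ≈⟨ ⊖-+-≡ a b ⟨
      (a ⊖[ n ] b) + toℕ b         ∎)
      where
      open ≡[mod]-Reasoning n
      c : Fin n
      c = (s + toℕ b) mod n

coprime-if-no-common-prime : ∀ {m x} .{{_ : NonZero m}} →
                             (∀ {l} → Prime l → l ∣ m → ¬ l ∣ x) → Coprime x m
coprime-if-no-common-prime {m} {x} no-common {d} (d∣x , d∣m) = d≡1 (factorise d {{d≢0}})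
  where
  d≢0 : NonZero d
  d≢0 = ≢-nonZero λ { refl → ≢-nonZero⁻¹ m (0∣⇒≡0 d∣m) }
  d≡1 : PrimeFactorisation d → d ≡ 1
  d≡1 record { factors = [] ; isFactorisation = d≡1 } = d≡1
  d≡1 record { factors = l ∷ ls ; isFactorisation = d≡l*ls ; factorsPrime = l-prime ∷ _ } =
    contradiction (∣-trans l∣d d∣x) (no-common l-prime (∣-trans l∣d d∣m))
    where
    l∣d : l ∣ d
    l∣d = subst (l ∣_) (sym d≡l*ls) (m∣m*n (product ls))

coprime-resp-≡[mod] : ∀ {m x y} → x ≡ y [mod m ] → Coprime x m → Coprime y m
coprime-resp-≡[mod] x≡y x⊥m (d∣y , d∣m) =
  x⊥m (∣-resp-≡[mod] (≡[mod]-divisor d∣m (≡[mod]-sym x≡y)) d∣y , d∣m)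

coprime-+≡0 : ∀ {m x y} → x + y ≡ 0 [mod m ] → Coprime y m → Coprime x m
coprime-+≡0 {x = x} {y} x+y≡0 y⊥m {d} (d∣x , d∣m) = y⊥m (∣m+n∣m⇒∣n d∣x+y d∣x , d∣m)
  where
  d∣x+y : d ∣ x + y
  d∣x+y = ∣-resp-≡[mod] (≡[mod]-divisor d∣m (≡[mod]-sym x+y≡0)) (_ ∣0)

≢⇒coprime-⊖ : ∀ {p} → Prime p → (a b : Fin p) → a ≢ b → Coprime (a ⊖[ p ] b) p
≢⇒coprime-⊖ p-prime a b a≢b {d} (d∣a⊖b , d∣p) with prime⇒irreducible p-prime d∣p
... | inj₁ d≡1 = d≡1
... | inj₂ refl = contradiction (toℕ-injective a≡b) a≢b
  where
  a≡b : toℕ a ≡ toℕ b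
  a≡b = ≡[mod]⇒≡ {{prime⇒nonZero p-prime}} (toℕ<n a) (toℕ<n b) (∣⊖⇒≡[mod] ∣-refl a b d∣a⊖b)

common-prime⇒¬coprime-⊖ : ∀ {l n} → Prime l → l ∣ n → (a b : Fin n) →
                          toℕ a ≡ toℕ b [mod l ] → ¬ Coprime (a ⊖[ n ] b) n
common-prime⇒¬coprime-⊖ l-prime l∣n a b a≡b a⊖b⊥n =
  ¬prime[1] (subst Prime (a⊖b⊥n (≡[mod]⇒∣⊖ l∣n a b a≡b , l∣n)) l-prime)

-- Every prime factor l of m divides exactly one of e and E, hence neither d = e + E nor e + d = 2e + E
-- (if l ∤ e, then l ∣ 2e + E would give l = 2, but 2 ∣ m forces 2 ∣ e).
∃-coprime-shift : ∀ {m} .{{_ : NonZero m}} e → (2 ∣ m → 2 ∣ e) →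
                  ∃[ d ] Coprime d m × Coprime (e + d) m
∃-coprime-shift {m} e even =
  e + E , coprime-if-no-common-prime (λ l l∣m → proj₁ (avoids l l∣m))
        , coprime-if-no-common-prime (λ l l∣m → proj₂ (avoids l l∣m))
  where
  fm : PrimeFactorisation m
  fm = factorise m
  E : ℕ
  E = product (filter (λ l → ¬? (l ∣? e)) (factors fm))

  ∣E : ∀ {l} → Prime l → l ∣ m → ¬ l ∣ e → l ∣ E
  ∣E {l} l-prime l∣m l∤e = ∈⇒∣product (∈-filter⁺ (λ l → ¬? (l ∣? e)) l∈fm l∤e)
    where
    l∈fm : l ∈ factors fm
    l∈fm = factorisationHasAllPrimeFactors l-prime
             (subst (_ ∣_) (isFactorisation fm) l∣m) (factorsPrime fm)

  ∤E : ∀ {l} → Prime l → l ∣ e → ¬ l ∣ E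
  ∤E {l} l-prime l∣e l∣E = proj₂ (∈-filter⁻ (λ l → ¬? (l ∣? e)) {xs = factors fm} l∈E) l∣e
    where
    l∈E : l ∈ filter (λ l → ¬? (l ∣? e)) (factors fm)
    l∈E = factorisationHasAllPrimeFactors l-prime l∣E (All.filter⁺ _ (factorsPrime fm))

  avoids : ∀ {l} → Prime l → l ∣ m → ¬ l ∣ e + E × ¬ l ∣ e + (e + E)
  avoids {l} l-prime l∣m with l ∣? e
  ... | yes l∣e = (λ l∣d → ∤E l-prime l∣e (∣m+n∣m⇒∣n l∣d l∣e))
                , (λ l∣e+d → ∤E l-prime l∣e (∣m+n∣m⇒∣n (∣m+n∣m⇒∣n l∣e+d l∣e) l∣e))
  ... | no l∤e = (λ l∣d → l∤e (∣m+n∣n⇒∣m l∣d l∣E))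
               , (λ l∣e+d → l∤2e (∣m+n∣n⇒∣m (subst (l ∣_) (sym (+-assoc e e E)) l∣e+d) l∣E))
    where
    l∣E : l ∣ E
    l∣E = ∣E l-prime l∣m l∤e
    ∣m+n∣n⇒∣m : ∀ {a b} → l ∣ a + b → l ∣ b → l ∣ a
    ∣m+n∣n⇒∣m {a} {b} l∣a+b = ∣m+n∣m⇒∣n (subst (l ∣_) (+-comm a b) l∣a+b)
    l∤2e : ¬ l ∣ e + e
    l∤2e l∣2e with euclidsLemma 2 e l-prime (subst (l ∣_) (cong (e +_) (sym (+-identityʳ e))) l∣2e)
    ... | inj₂ l∣e = l∤e l∣e
    ... | inj₁ l∣2 with prime⇒irreducible prime[2] l∣2
    ...   | inj₁ refl = ¬prime[1] l-prime
    ...   | inj₂ refl = l∤e (even l∣m)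

∃-coprime-midpoint : ∀ {m} .{{_ : NonZero m}} (v v' : Fin m) → (2 ∣ m → 2 ∣ v ⊖[ m ] v') →
                     ∃[ c ] Coprime (v ⊖[ m ] c) m × Coprime (c ⊖[ m ] v') m
∃-coprime-midpoint {m} v v' even with ∃-coprime-shift (v ⊖[ m ] v') even
... | d , d⊥m , e+d⊥m = c , coprime-+≡0 v⊖c+d≡0 d⊥m
                          , coprime-resp-≡[mod] (≡[mod]-sym (⊖-shift (e + d) v')) e+d⊥m
  where
  e : ℕ
  e = v ⊖[ m ] v'
  c : Fin m
  c = ((e + d) + toℕ v') mod m
  v⊖c+d≡0 : (v ⊖[ m ] c) + d ≡ 0 [mod m ]
  v⊖c+d≡0 = +-cancelʳ[mod] e (begin
    ((v ⊖[ m ] c) + d) + e   ≡⟨ rearrange (v ⊖[ m ] c) d e ⟩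
    (v ⊖[ m ] c) + (e + d)   ≈⟨ ⊖-+-shift (e + d) v v' ⟩
    e                        ∎)
    where
    open ≡[mod]-Reasoning m
    rearrange : ∀ x y z → (x + y) + z ≡ x + (z + y)
    rearrange = solve-∀

module _ {p m : ℕ} .{{_ : NonZero m}} (p-prime : Prime p) where

  walk₂ : {ux uy a : Fin p} {vx vy : Fin m} → a ≢ ux → a ≢ uy →
          (2 ∣ m → 2 ∣ vx ⊖[ m ] vy) → Walk p m (ux , vx) (uy , vy) 2
  walk₂ {ux} {uy} {a} {vx} {vy} a≢ux a≢uy even =
    let c , vx⊖c⊥m , c⊖vy⊥m = ∃-coprime-midpoint vx vy even
    in step {y = a , c} (≢⇒coprime-⊖ p-prime ux a (≢-sym a≢ux) , vx⊖c⊥m)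
         (step (≢⇒coprime-⊖ p-prime a uy a≢uy , c⊖vy⊥m) here)

  adjacent-successor : {u a : Fin p} → a ≢ u → (v : Fin m) → Adj p m (u , v) (a , (1 + toℕ v) mod m)
  adjacent-successor {u} {a} a≢u v =
    ≢⇒coprime-⊖ p-prime u a (≢-sym a≢u) , coprime-+≡0 v⊖w+1≡0 (1-coprimeTo m)
    where
    v⊖w+1≡0 : (v ⊖[ m ] ((1 + toℕ v) mod m)) + 1 ≡ 0 [mod m ]
    v⊖w+1≡0 = ≡[mod]-trans (⊖-+-shift 1 v v) (⊖-self v)

  walk₃ : 2 ∣ m → {ux uy a b : Fin p} {vx vy : Fin m} → a ≢ ux → b ≢ a → b ≢ uy →
          1 + toℕ vx ≡ toℕ vy [mod 2 ] → Walk p m (ux , vx) (uy , vy) 3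
  walk₃ 2∣m {vx = vx} {vy} a≢ux b≢a b≢uy 1+vx≡vy =
    step (adjacent-successor a≢ux vx) (walk₂ b≢a b≢uy (λ _ → ≡[mod]⇒∣⊖ 2∣m w vy w≡vy))
    where
    w : Fin m
    w = (1 + toℕ vx) mod m
    w≡vy : toℕ w ≡ toℕ vy [mod 2 ]
    w≡vy = ≡[mod]-trans (≡[mod]-divisor 2∣m (toℕ-mod (1 + toℕ vx))) 1+vx≡vy

step-flips-parity : ∀ {n} → 2 ∣ n → (a b : Fin n) → Coprime (a ⊖[ n ] b) n → 1 + toℕ b ≡ toℕ a [mod 2 ]
step-flips-parity {n} 2∣n a b a⊖b⊥n = begin
  1 + toℕ b               ≈⟨ +-cong[mod] (odd⇒≡1[mod2] a⊖b-odd) ≡[mod]-refl ⟨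
  (a ⊖[ n ] b) + toℕ b    ≈⟨ ≡[mod]-divisor 2∣n (⊖-+-≡ a b) ⟩
  toℕ a                   ∎
  where
  open ≡[mod]-Reasoning 2
  a⊖b-odd : ¬ 2 ∣ a ⊖[ n ] b
  a⊖b-odd 2∣a⊖b with a⊖b⊥n (2∣a⊖b , 2∣n)
  ... | ()

module _ {p m : ℕ} where

  walk-parity : (f : V p m → ℕ) → (∀ {x y} → Adj p m x y → 1 + f y ≡ f x [mod 2 ]) →
                ∀ {x y k} → Walk p m x y k → k + f x ≡ f y [mod 2 ]
  walk-parity f flips here = ≡[mod]-refl
  walk-parity f flips {x} {z} {suc k} (step {y = y} x~y w) = begin
    suc k + f x           ≡⟨ +-suc k (f x) ⟨
    k + (1 + f x)         ≈⟨ +-cong[mod] (≡[mod]-refl {x = k}) (+-cong[mod] (≡[mod]-refl {x = 1}) (flips x~y)) ⟨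
    k + (2 + f y)         ≈⟨ +-cong[mod] (≡[mod]-refl {x = k}) (n+x≡x[mod] (f y)) ⟩
    k + f y               ≈⟨ walk-parity f flips w ⟩
    f z                   ∎
    where open ≡[mod]-Reasoning 2

  walk-parity₁ : 2 ∣ p → ∀ {x y k} → Walk p m x y k → k + toℕ (proj₁ x) ≡ toℕ (proj₁ y) [mod 2 ]
  walk-parity₁ 2∣p = walk-parity (toℕ ∘ proj₁) λ {x} {y} x~y → step-flips-parity 2∣p (proj₁ x) (proj₁ y) (proj₁ x~y)

  walk-parity₂ : 2 ∣ m → ∀ {x y k} → Walk p m x y k → k + toℕ (proj₂ x) ≡ toℕ (proj₂ y) [mod 2 ]
  walk-parity₂ 2∣m = walk-parity (toℕ ∘ proj₂) λ {x} {y} x~y → step-flips-parity 2∣m (proj₂ x) (proj₂ y) (proj₂ x~y)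

  walk₀⇒≡ : ∀ {x y} → Walk p m x y 0 → x ≡ y
  walk₀⇒≡ here = refl

  walk₁⇒adjacent : ∀ {x y} → Walk p m x y 1 → Adj p m x y
  walk₁⇒adjacent (step x~y here) = x~y

∃-nonzero-avoiding : ∀ {n} (u : Fin (3 + n)) → ∃[ a ] a ≢ zero × a ≢ u
∃-nonzero-avoiding u with suc zero ≟ᶠ u
... | no 1≢u   = suc zero , (λ ()) , 1≢u
... | yes refl = suc (suc zero) , (λ ()) , (λ ())

∃-avoiding-two : ∀ {n} → 3 ≤ n → (u u' : Fin n) → ∃[ a ] a ≢ u × a ≢ u'
∃-avoiding-two (s≤s (s≤s (s≤s _))) u u' with zero ≟ᶠ u | zero ≟ᶠ u'
... | no 0≢u   | no 0≢u'  = zero , 0≢u , 0≢u'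
... | yes refl | _        = ∃-nonzero-avoiding u'
... | no _     | yes refl = let a , a≢0 , a≢u = ∃-nonzero-avoiding u in a , a≢u , a≢0

other-than : (u : Fin 2) → ∃[ a ] a ≢ u
other-than zero       = suc zero , λ ()
other-than (suc zero) = zero , λ ()

≢⇒1+≡[mod2] : (a b : Fin 2) → a ≢ b → 1 + toℕ a ≡ toℕ b [mod 2 ]
≢⇒1+≡[mod2] zero       zero       a≢b = contradiction refl a≢b
≢⇒1+≡[mod2] zero       (suc zero) _   = ≡[mod]-refl
≢⇒1+≡[mod2] (suc zero) zero       _   = n+x≡x[mod] 0
≢⇒1+≡[mod2] (suc zero) (suc zero) a≢b = contradiction refl a≢b

same-or-opposite-parity : ∀ x y → x ≡ y [mod 2 ] ⊎ 1 + x ≡ y [mod 2 ]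
same-or-opposite-parity x y with parity x | parity y
... | inj₁ x≡0 | inj₁ y≡0 = inj₁ (≡[mod]-trans x≡0 (≡[mod]-sym y≡0))
... | inj₂ x≡1 | inj₂ y≡1 = inj₁ (≡[mod]-trans x≡1 (≡[mod]-sym y≡1))
... | inj₁ x≡0 | inj₂ y≡1 = inj₂ (≡[mod]-trans (+-cong[mod] (≡[mod]-refl {x = 1}) x≡0) (≡[mod]-sym y≡1))
... | inj₂ x≡1 | inj₁ y≡0 =
  inj₂ (≡[mod]-trans (+-cong[mod] (≡[mod]-refl {x = 1}) x≡1) (≡[mod]-trans (n+x≡x[mod] 0) (≡[mod]-sym y≡0)))

diameter-2 : ∀ {p m} .{{_ : NonZero m}} → Prime p → p ∣ m →
             (∀ ℓ → Prime ℓ → ℓ ∣ m → 3 ≤ ℓ) → Diameter p m 2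
diameter-2 {p} {m} p-prime p∣m odd-factors =
  (λ x y _ → 2 , ≤-refl , walk₂-everywhere x y) , x , y , walk₂-everywhere x y , shorter
  where
  instance _ = prime⇒nonZero p-prime
  2∤m : ¬ 2 ∣ m
  2∤m 2∣m with odd-factors 2 prime[2] 2∣m
  ... | s≤s (s≤s ())

  walk₂-everywhere : ∀ x y → Walk p m x y 2
  walk₂-everywhere (ux , vx) (uy , vy) =
    let a , a≢ux , a≢uy = ∃-avoiding-two (odd-factors p p-prime p∣m) ux uy
    in walk₂ p-prime a≢ux a≢uy (λ 2∣m → contradiction 2∣m 2∤m)

  x y : V p m
  x = 0 mod p , 0 mod m
  y = 1 mod p , 0 mod m

  shorter : ∀ k → k < 2 → ¬ Walk p m x y k
  shorter 0 _ w = ¬prime[1] (subst Prime (∣1⇒≡1 (∣-resp-≡[mod] 0≡1 (p ∣0))) p-prime)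
    where
    open ≡[mod]-Reasoning p
    0≡1 : 0 ≡ 1 [mod p ]
    0≡1 = begin
      0                  ≈⟨ toℕ-mod 0 ⟨
      toℕ (0 mod p)      ≡⟨ cong (toℕ ∘ proj₁) (walk₀⇒≡ w) ⟩
      toℕ (1 mod p)      ≈⟨ toℕ-mod 1 ⟩
      1                  ∎
  shorter 1 _ w = common-prime⇒¬coprime-⊖ p-prime p∣m (0 mod m) (0 mod m) ≡[mod]-refl (proj₂ (walk₁⇒adjacent w))
  shorter (suc (suc _)) (s≤s (s≤s ()))

diameter-3-odd-p : ∀ {p m} .{{_ : NonZero m}} → Prime p → 3 ≤ p → 2 ∣ m → Diameter p m 3
diameter-3-odd-p {p} {m} p-prime 3≤p 2∣m = walk≤3 , x , y , walk₃-opposite 1+v₀≡v₁ , shorter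
  where
  instance _ = prime⇒nonZero p-prime
  open ≡[mod]-Reasoning 2

  walk₂-same : ∀ {ux uy vx vy} → toℕ vx ≡ toℕ vy [mod 2 ] → Walk p m (ux , vx) (uy , vy) 2
  walk₂-same {ux} {uy} {vx} {vy} vx≡vy =
    let a , a≢ux , a≢uy = ∃-avoiding-two 3≤p ux uy
    in walk₂ p-prime a≢ux a≢uy (λ _ → ≡[mod]⇒∣⊖ 2∣m vx vy vx≡vy)

  walk₃-opposite : ∀ {ux uy vx vy} → 1 + toℕ vx ≡ toℕ vy [mod 2 ] → Walk p m (ux , vx) (uy , vy) 3
  walk₃-opposite {ux} {uy} =
    let a , a≢ux , _ = ∃-avoiding-two 3≤p ux ux
        b , b≢a , b≢uy = ∃-avoiding-two 3≤p a uy
    in walk₃ p-prime 2∣m a≢ux b≢a b≢uy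

  walk≤3 : ∀ x y → Reachable p m x y → ∃[ k ] k ≤ 3 × Walk p m x y k
  walk≤3 (_ , vx) (_ , vy) _ with same-or-opposite-parity (toℕ vx) (toℕ vy)
  ... | inj₁ same     = 2 , s≤s (s≤s z≤n) , walk₂-same same
  ... | inj₂ opposite = 3 , ≤-refl , walk₃-opposite opposite

  u₀ : Fin p
  u₀ = 0 mod p
  v₀ v₁ : Fin m
  v₀ = 0 mod m
  v₁ = 1 mod m
  x y : V p m
  x = u₀ , v₀
  y = u₀ , v₁

  v₀≡0 : toℕ v₀ ≡ 0 [mod 2 ]
  v₀≡0 = ≡[mod]-divisor 2∣m (toℕ-mod 0)
  v₁≡1 : toℕ v₁ ≡ 1 [mod 2 ]
  v₁≡1 = ≡[mod]-divisor 2∣m (toℕ-mod 1)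

  1+v₀≡v₁ : 1 + toℕ v₀ ≡ toℕ v₁ [mod 2 ]
  1+v₀≡v₁ = ≡[mod]-trans (+-cong[mod] (≡[mod]-refl {x = 1}) v₀≡0) (≡[mod]-sym v₁≡1)

  odd-length : ∀ {k} → Walk p m x y k → k ≡ 1 [mod 2 ]
  odd-length {k} w = begin
    k            ≡⟨ +-identityʳ k ⟨
    k + 0        ≈⟨ +-cong[mod] (≡[mod]-refl {x = k}) v₀≡0 ⟨
    k + toℕ v₀   ≈⟨ walk-parity₂ 2∣m w ⟩
    toℕ v₁       ≈⟨ v₁≡1 ⟩
    1            ∎

  shorter : ∀ k → k < 3 → ¬ Walk p m x y k
  shorter 0 _ w = 0≢1[mod2] (odd-length w)
  shorter 1 _ w = common-prime⇒¬coprime-⊖ p-prime ∣-refl u₀ u₀ ≡[mod]-refl (proj₁ (walk₁⇒adjacent w))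
  shorter 2 _ w = 0≢1[mod2] (≡[mod]-trans (≡[mod]-sym (n+x≡x[mod] 0)) (odd-length w))
  shorter (suc (suc (suc _))) (s≤s (s≤s (s≤s ())))

-- The far vertex is (1 , q): walks to it from (0 , 0) have odd length, q ∣ m rules out length 1,
-- and q being odd is what makes the walk of length 3 exist.
diameter-3-p≡2 : ∀ {q m} .{{_ : NonZero m}} → 2 ∣ m → Prime q → q ∣ m → q ≢ 2 → Diameter 2 m 3
diameter-3-p≡2 {q} {m} 2∣m q-prime q∣m q≢2 =
  walk≤3 , x , y , walk₃ prime[2] 2∣m {a = suc zero} {b = zero} (λ ()) (λ ()) (λ ()) 1+v₀≡v_q , shorter
  where
  q-odd : ¬ 2 ∣ q
  q-odd 2∣q with prime⇒irreducible q-prime 2∣q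
  ... | inj₂ 2≡q = q≢2 (sym 2≡q)

  v-parity-follows-u : ∀ {ux uy vx vy k} → Walk 2 m (ux , vx) (uy , vy) k →
                       ∀ j → j + toℕ ux ≡ toℕ uy [mod 2 ] → j + toℕ vx ≡ toℕ vy [mod 2 ]
  v-parity-follows-u {ux} {uy} {vx} {vy} {k} w j j+ux≡uy =
    ≡[mod]-trans (+-cong[mod] j≡k (≡[mod]-refl {x = toℕ vx})) (walk-parity₂ 2∣m w)
    where
    j≡k : j ≡ k [mod 2 ]
    j≡k = +-cancelʳ[mod] (toℕ ux) (≡[mod]-trans j+ux≡uy (≡[mod]-sym (walk-parity₁ ∣-refl w)))

  walk≤3 : ∀ x y → Reachable 2 m x y → ∃[ k ] k ≤ 3 × Walk 2 m x y k
  walk≤3 (ux , vx) (uy , vy) (_ , w) with ux ≟ᶠ uy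
  ... | yes refl =
    let a , a≢ux = other-than ux
    in 2 , s≤s (s≤s z≤n) , walk₂ prime[2] a≢ux a≢ux
                             (λ _ → ≡[mod]⇒∣⊖ 2∣m vx vy (v-parity-follows-u w 0 ≡[mod]-refl))
  ... | no ux≢uy =
    3 , ≤-refl , walk₃ prime[2] 2∣m (≢-sym ux≢uy) ux≢uy ux≢uy
                   (v-parity-follows-u w 1 (≢⇒1+≡[mod2] ux uy ux≢uy))

  v₀ v_q : Fin m
  v₀ = 0 mod m
  v_q = q mod m
  x y : V 2 m
  x = zero , v₀
  y = suc zero , v_q

  1+v₀≡v_q : 1 + toℕ v₀ ≡ toℕ v_q [mod 2 ]
  1+v₀≡v_q = begin
    1 + toℕ v₀   ≈⟨ +-cong[mod] (≡[mod]-refl {x = 1}) (≡[mod]-divisor 2∣m (toℕ-mod 0)) ⟩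
    1            ≈⟨ odd⇒≡1[mod2] q-odd ⟨
    q            ≈⟨ ≡[mod]-divisor 2∣m (toℕ-mod q) ⟨
    toℕ v_q      ∎
    where open ≡[mod]-Reasoning 2

  v₀≡v_q : toℕ v₀ ≡ toℕ v_q [mod q ]
  v₀≡v_q = begin
    toℕ v₀       ≈⟨ ≡[mod]-divisor q∣m (toℕ-mod 0) ⟩
    0            ≈⟨ ∣⇒≡0[mod] ∣-refl ⟨
    q            ≈⟨ ≡[mod]-divisor q∣m (toℕ-mod q) ⟨
    toℕ v_q      ∎
    where open ≡[mod]-Reasoning q

  shorter : ∀ k → k < 3 → ¬ Walk 2 m x y k
  shorter 0 _ w = 0≢1[mod2] (walk-parity₁ ∣-refl w)
  shorter 1 _ w = common-prime⇒¬coprime-⊖ q-prime q∣m v₀ v_q v₀≡v_q (proj₂ (walk₁⇒adjacent w))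
  shorter 2 _ w = 0≢1[mod2] (≡[mod]-trans (≡[mod]-sym (n+x≡x[mod] 0)) (walk-parity₁ ∣-refl w))
  shorter (suc (suc (suc _))) (s≤s (s≤s (s≤s ())))

m∣m^n : ∀ {m n} → 1 ≤ n → m ∣ m ^ n
m∣m^n {m} {suc n} _ = m∣m*n (m ^ n)

diameters : ∀ {p q m} .{{_ : NonZero m}} → Prime p → Prime q → p ≢ q → p ∣ m → q ∣ m →
            (2 ∣ m → Diameter p m 3) × ((∀ ℓ → Prime ℓ → ℓ ∣ m → 3 ≤ ℓ) → Diameter p m 2)
diameters {p} {m = m} p-prime q-prime p≢q p∣m q∣m = diameter-3 , diameter-2 p-prime p∣m
  where
  diameter-3 : 2 ∣ m → Diameter p m 3
  diameter-3 2∣m with p ≟ 2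
  ... | yes refl = diameter-3-p≡2 2∣m q-prime q∣m (≢-sym p≢q)
  ... | no p≢2   = diameter-3-odd-p p-prime (≤∧≢⇒< 2≤p (≢-sym p≢2)) 2∣m
    where
    2≤p : 2 ≤ p
    2≤p = nonTrivial⇒n>1 p {{prime⇒nonTrivial p-prime}}

theorem4p8 : (p q r α β γ m : ℕ) →
  Prime p → Prime q → Prime r →
  ¬ p ≡ q → ¬ p ≡ r → ¬ q ≡ r →
  1 ≤ α → 1 ≤ β → 1 ≤ γ →
  (m ≡ p ^ α * q ^ β ⊎ m ≡ p ^ α * q ^ β * r ^ γ) →
  (2 ∣ m → Diameter p m 3)
  × ((∀ ℓ → Prime ℓ → ℓ ∣ m → 3 ≤ ℓ) → Diameter p m 2)
theorem4p8 p q r α β γ m p-prime q-prime r-prime p≢q _ _ α≥1 β≥1 _ m≡ =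
  diameters p-prime q-prime p≢q (∣-trans (∣m⇒∣m*n (q ^ β) (m∣m^n α≥1)) pᵅqᵝ∣m)
                                (∣-trans (∣n⇒∣m*n (p ^ α) (m∣m^n β≥1)) pᵅqᵝ∣m)
  where
  instance
    _ = prime⇒nonZero p-prime
    _ = prime⇒nonZero q-prime
    _ = prime⇒nonZero r-prime
    _ = m^n≢0 p α
    _ = m^n≢0 q β
    _ = m^n≢0 r γ
    _ = m*n≢0 (p ^ α) (q ^ β)
    m≢0 : NonZero m
    m≢0 = [ (λ { refl → m*n≢0 (p ^ α) (q ^ β) }) , (λ { refl → m*n≢0 (p ^ α * q ^ β) (r ^ γ) }) ] m≡
  pᵅqᵝ∣m : p ^ α * q ^ β ∣ m
  pᵅqᵝ∣m = [ (λ { refl → ∣-refl }) , (λ { refl → m∣m*n (r ^ γ) }) ] m≡
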